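{- Let $\varphi$ be a CNF formula in which every clause consists of three literals and every variable occurs in two or three clauses, let $G=G(\varphi)$ be the graph constructed below, and let $\prec$ be an elimination order for $G$. Let $l$ be a literal appearing in clauses $c_1,\dots,c_p$ and let $r_l$ be its representative. Assume that the $\prec$-last vertex $v$ of $\mathrm{Var}(l)$ is adjacent to every vertex of $N_G(r_l)$. Then for each $i\in[p]$ there is a vertex $x_i$ of $\mathrm{Clause}(c_i)$ with $x_i\prec v$.
   Context: Construction of $G(\varphi)$. For each variable $v$ occurring in $p$ clauses, of which $b$ contain the literal $v$ and $a$ contain $\neg v$ ($a+b=p$), the variable gadget $\mathrm{Var}(v)$ is an independent set of $2p+1$ vertices: $v_0$ (representative of $\neg v$), $v_1$ (representative of $v$), and transition vertices $t_1,\dots,t_{2p-1}$; $\mathrm{Var}(l)$ denotes $\mathrm{Var}(v)$ for a literal $l$ of $v$. For each clause $c=l_1\lor l_2\lor l_3$, the clause gadget $\mathrm{Clause}(c)$ is a clique on five vertices $c_\top, c_{l_1}, c_{l_2}, c_{l_3}, c_\bot$. Add two further vertices $\gamma$ and $\iota$. Edges: (1) for each clause $c=l_1\lor l_2\lor l_3$ and $i\in[3]$, both $c_{l_i}$ and $c_\top$ are joined to the representative of $l_i$; (2) each $c_\bot$ is joined to $\gamma$; (3) for each variable $v$: after (1), $N(v_0)=\{x_1,\dots,x_{2a}\}$ is ordered so that $x_1,\dots,x_a$ are of the form $c_\top$ and $x_{a+1},\dots,x_{2a}$ of the form $c_{l}$; $N(v_1)=\{y_1,\dots,y_{2b}\}$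 is ordered so that $y_1,\dots,y_b$ are of the form $c_l$ and $y_{b+1},\dots,y_{2b}$ of the form $c_\top$; set $N(t_1)=N(v_0)\cup\{y_1\}$, $N(t_i)=N(t_{i-1})\cup\{y_i\}$ for $i\in[2,2b]$, and $N(t_i)=N(t_{i-1})\setminus\{x_{i-2b}\}$ for $i\in[2b+1,2a+2b-1]$. The vertex $\iota$ is isolated. No other edges. Two distinct vertices $u,v$ of a graph $H$ are $1$-twins if $|(N_H(u)\setminus N_H[v])\cup(N_H(v)\setminus N_H[u])|\le 1$. An elimination order of $G$ is a total order $\prec$ on $V(G)$, listing $V(G)$ as $u_1\prec\dots\prec u_N$, such that for each $i\in[N-1]$, $u_i$ has a $1$-twin in $G-\{u_1,\dots,u_{i-1}\}$. -}

module Defs where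

open import Data.Nat using (ℕ; zero; suc; _+_; _*_; _∸_; _<_; _≤_)
open import Data.Fin using (Fin; zero; suc; toℕ)
open import Data.Bool using (Bool; true; false; _∧_; _∨_; if_then_else_)
import Data.Bool as B
import Data.Fin as F
open import Data.Product using (Σ; ∃; _×_; _,_; proj₁; proj₂)
open import Data.Sum using (_⊎_)
open import Relation.Nullary using (¬_)
open import Relation.Nullary.Decidable using (⌊_⌋)
open import Relation.Binary.PropositionalEquality using (_≡_; _≢_)

-- A literal over variables Fin n: (v , true) is the literal v,
-- (v , false) is the literal ¬ v.
Lit : ℕ → Set
Lit n = Fin n × Bool

var : ∀ {n} → Lit n → Fin n
var = proj₁

Clause : ℕ → Set
Clause n = Fin 3 → Lit n

CNF : ℕ → ℕ → Set
CNF n m = Fin m → Clause n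

p0 p1 p2 : Fin 3
p0 = zero
p1 = suc zero
p2 = suc (suc zero)

litEq : ∀ {n} → Lit n → Lit n → Bool
litEq (v , s) (v' , s') = ⌊ v F.≟ v' ⌋ ∧ ⌊ s B.≟ s' ⌋

hasLit : ∀ {n} → Clause n → Lit n → Bool
hasLit c l = litEq (c p0) l ∨ (litEq (c p1) l ∨ litEq (c p2) l)

hasVar : ∀ {n} → Clause n → Fin n → Bool
hasVar c v = ⌊ var (c p0) F.≟ v ⌋ ∨ (⌊ var (c p1) F.≟ v ⌋ ∨ ⌊ var (c p2) F.≟ v ⌋)

count : ∀ {m} → (Fin m → Bool) → ℕ
count {zero} f = 0
count {suc m} f = (if f zero then 1 else 0) + count (λ j → f (suc j))

occ : ∀ {n m} → CNF n m → Fin n → ℕ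
occ φ v = count (λ j → hasVar (φ j) v)

-- The three literals of every clause are on three distinct variables
-- (implicit in the paper: a clause is a set of three literals and a + b = p).
DistinctVars : ∀ {n m} → CNF n m → Set
DistinctVars φ = ∀ j k k' → var (φ j k) ≡ var (φ j k') → k ≡ k'

module Construction {n m : ℕ} (φ : CNF n m) where

  a b p : Fin n → ℕ
  a v = count (λ j → hasLit (φ j) (v , false))
  b v = count (λ j → hasLit (φ j) (v , true))
  p v = a v + b v

  -- vertices of G(φ)
  --   rep v false = v₀ (representative of ¬ v), rep v true = v₁ (representative of v)
  --   tr v i      = t_{i+1},  i ∈ {0 , … , 2p-2}
  --   top j, clit j k, bot j = c_⊤ , c_{l_k} , c_⊥ of clause j
  data Vtx : Set where
    rep  : Fin n → Bool → Vtx
    tr   : (v : Fin n) → Fin (2 * p v ∸ 1) → Vtx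
    top  : Fin m → Vtx
    clit : Fin m → Fin 3 → Vtx
    bot  : Fin m → Vtx
    γ    : Vtx
    ι    : Vtx

  repOf : Lit n → Vtx
  repOf (v , s) = rep v s

  data InVar (v : Fin n) : Vtx → Set where
    inRep : ∀ s → InVar v (rep v s)
    inTr  : ∀ i → InVar v (tr v i)

  data InClause (j : Fin m) : Vtx → Set where
    inTop : InClause j (top j)
    inLit : ∀ k → InClause j (clit j k)
    inBot : InClause j (bot j)

  IsTop IsLitV : Vtx → Set
  IsTop u = ∃ λ j → u ≡ top j
  IsLitV u = ∃ λ j → ∃ λ k → u ≡ clit j k

  -- edges of type (1), oriented from the representative to the clause vertex
  data E1 : Vtx → Vtx → Set where
    e-lit : ∀ j k → E1 (repOf (φ j k)) (clit j k)
    e-top : ∀ j k → E1 (repOf (φ j k)) (top j)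

  -- The orderings x₁,…,x_{2a} of N(v₀) and y₁,…,y_{2b} of N(v₁) chosen in
  -- step (3) (0-based: X v k = x_{k+1}, Y v k = y_{k+1}).
  record Orderings : Set where
    field
      X : (v : Fin n) → Fin (2 * a v) → Vtx
      Y : (v : Fin n) → Fin (2 * b v) → Vtx
      X-inj   : ∀ v k k' → X v k ≡ X v k' → k ≡ k'
      X-into  : ∀ v k → E1 (rep v false) (X v k)
      X-onto  : ∀ v u → E1 (rep v false) u → ∃ λ k → X v k ≡ u
      X-top   : ∀ v k → toℕ k < a v → IsTop (X v k)
      X-lit   : ∀ v k → a v ≤ toℕ k → IsLitV (X v k)
      Y-inj   : ∀ v k k' → Y v k ≡ Y v k' → k ≡ k'
      Y-into  : ∀ v k → E1 (rep v true) (Y v k)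
      Y-onto  : ∀ v u → E1 (rep v true) u → ∃ λ k → Y v k ≡ u
      Y-lit   : ∀ v k → toℕ k < b v → IsLitV (Y v k)
      Y-top   : ∀ v k → b v ≤ toℕ k → IsTop (Y v k)

  module WithOrderings (O : Orderings) where
    open Orderings O

    -- u ∈ N(t_{i+1}) = N(v₀) ∪ {y₁,…,y_{min(i+1,2b)}} ∖ {x₁,…,x_{(i+1)-2b}}
    TNbr : (v : Fin n) → Fin (2 * p v ∸ 1) → Vtx → Set
    TNbr v i u =
      (E1 (rep v false) u ⊎ (∃ λ k → toℕ k < suc (toℕ i) × Y v k ≡ u))
      × ¬ (∃ λ k → toℕ k < suc (toℕ i) ∸ 2 * b v × X v k ≡ u)

    data E : Vtx → Vtx → Set where
      e-clique : ∀ j {u w} → InClause j u → InClause j w → u ≢ w → E u w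
      e-one    : ∀ {u w} → E1 u w → E u w
      e-two    : ∀ j → E (bot j) γ
      e-three  : ∀ v i u → TNbr v i u → E (tr v i) u

    Adj : Vtx → Vtx → Set
    Adj u w = E u w ⊎ E w u

    -- u and w are 1-twins in the induced subgraph G[S]:
    -- |(N(u) ∖ N[w]) ∪ (N(w) ∖ N[u])| ≤ 1 (neighbourhoods taken inside S)
    Sym : (S : Vtx → Set) → Vtx → Vtx → Vtx → Set
    Sym S u w x = S x × ((Adj u x × x ≢ w × ¬ Adj w x) ⊎ (Adj w x × x ≢ u × ¬ Adj u x))

    OneTwins : (S : Vtx → Set) → Vtx → Vtx → Set
    OneTwins S u w = u ≢ w × S u × S w ×
                     (∀ x y → Sym S u w x → Sym S u w y → x ≡ y)

    -- A total order ≺ on V(G) given by an injective rank function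
    -- (u ≺ w iff ord u < ord w).
    IsEliminationOrder : (Vtx → ℕ) → Set
    IsEliminationOrder ord =
      (∀ u w → ord u ≡ ord w → u ≡ w) ×
      (∀ u → (∃ λ w → ord u < ord w) →
         ∃ λ w → OneTwins (λ x → ¬ (ord x < ord u)) u w)

-- Suppose no vertex of Clause(c) precedes w, the last vertex of Var(l).  Then w is not
-- ≺-last, so it has a 1-twin w' among the vertices not before w.  Inside Clause(c), w is
-- adjacent exactly to c_⊤ and c_l.  If w' lies in Clause(c), it sees the other clause
-- vertices, two of which (among c_⊥ and the two other literal vertices) w does not see.
-- Otherwise w' misses c_l, whose outside neighbours all lie in Var(l) (and w is the last
-- of those), and w' misses c_⊤ too: an outside neighbour of c_⊤ also sees some literal
-- vertex of c, which is either c_l or not seen by w.  Either way w and w' differ on two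
-- vertices.
module Submission where

open import Defs
open import Data.Nat using (ℕ; _<_; _≤_)
open import Data.Nat.Properties using (<-trans; <-≤-trans; ≰⇒>; ≮⇒≥; ≤∧≢⇒<; ≤-antisym; _<?_)
open import Data.Fin using (Fin; zero; suc; toℕ)
import Data.Fin as F
import Data.Fin.Properties as F
import Data.Bool as B
open import Data.Bool using (true; false; _∨_)
open import Data.Product using (∃; _×_; proj₂; _,_)
open import Data.Sum using (_⊎_; inj₁; inj₂)
open import Data.Empty using (⊥; ⊥-elim)
open import Relation.Nullary using (¬_; Dec; yes; no)
open import Relation.Nullary.Decidable using (map′; _⊎-dec_)
open import Relation.Binary.PropositionalEquality using (_≡_; _≢_; refl; sym; trans; subst)

litEq⇒≡ : ∀ {n} (l l' : Lit n) → litEq l l' ≡ true → l ≡ l'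
litEq⇒≡ (v , s) (v' , s') eq with v F.≟ v' | s B.≟ s'
litEq⇒≡ (v , s) (v' , s') eq  | yes refl | yes refl = refl
litEq⇒≡ (v , s) (v' , s') ()  | yes refl | no _
litEq⇒≡ (v , s) (v' , s') ()  | no _     | _

∨-≡true : ∀ x {y} → x ∨ y ≡ true → x ≡ true ⊎ y ≡ true
∨-≡true true  _ = inj₁ refl
∨-≡true false e = inj₂ e

hasLit⇒position : ∀ {n} (c : Clause n) l → hasLit c l ≡ true → ∃ λ k → c k ≡ l
hasLit⇒position c l h with ∨-≡true (litEq (c p0) l) h
... | inj₁ e = p0 , litEq⇒≡ _ _ e
... | inj₂ h′ with ∨-≡true (litEq (c p1) l) h′
...   | inj₁ e = p1 , litEq⇒≡ _ _ e
...   | inj₂ e = p2 , litEq⇒≡ _ _ e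

false≢true : false ≢ true
false≢true ()

avoid : (a b : Fin 3) → ∃ λ c → c ≢ a × c ≢ b
avoid zero             zero             = p1 , (λ ()) , (λ ())
avoid zero             (suc zero)       = p2 , (λ ()) , (λ ())
avoid zero             (suc (suc zero)) = p1 , (λ ()) , (λ ())
avoid (suc zero)       zero             = p2 , (λ ()) , (λ ())
avoid (suc zero)       (suc zero)       = p0 , (λ ()) , (λ ())
avoid (suc zero)       (suc (suc zero)) = p0 , (λ ()) , (λ ())
avoid (suc (suc zero)) zero             = p1 , (λ ()) , (λ ())
avoid (suc (suc zero)) (suc zero)       = p0 , (λ ()) , (λ ())
avoid (suc (suc zero)) (suc (suc zero)) = p0 , (λ ()) , (λ ())

module Neighbourhoods {n m} (φ : CNF n m) where
  open Construction φ

  InVar-unique : ∀ {v v′ x} → InVar v x → InVar v′ x → v ≡ v′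
  InVar-unique (inRep s) (inRep .s) = refl
  InVar-unique (inTr i)  (inTr .i)  = refl

  InVar⇒¬InClause : ∀ {v j x} → InVar v x → ¬ InClause j x
  InVar⇒¬InClause (inRep s) ()
  InVar⇒¬InClause (inTr i)  ()

  repOf∈Var : ∀ l → InVar (var l) (repOf l)
  repOf∈Var (v , s) = inRep s

  γ∉Var : ∀ {v} → ¬ InVar v γ
  γ∉Var ()

  rep≡repOf⇒var : ∀ {v s} l → rep v s ≡ repOf l → v ≡ var l
  rep≡repOf⇒var (v , s) refl = refl

  InClause-any? : ∀ {P : Vtx → Set} j → (∀ x → Dec (P x)) → Dec (∃ λ x → InClause j x × P x)
  InClause-any? {P} j P? =
    map′ to from (P? (top j) ⊎-dec F.any? (λ k → P? (clit j k)) ⊎-dec P? (bot j))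
    where
    Cases = P (top j) ⊎ (∃ λ k → P (clit j k)) ⊎ P (bot j)
    to : Cases → ∃ λ x → InClause j x × P x
    to (inj₁ q)             = top j , inTop , q
    to (inj₂ (inj₁ (k , q))) = clit j k , inLit k , q
    to (inj₂ (inj₂ q))      = bot j , inBot , q
    from : (∃ λ x → InClause j x × P x) → Cases
    from (_ , inTop   , q) = inj₁ q
    from (_ , inLit k , q) = inj₂ (inj₁ (k , q))
    from (_ , inBot   , q) = inj₂ (inj₂ q)

  top≢clit : ∀ {j j′ k} → top j ≢ clit j′ k
  top≢clit ()

  E1-source : ∀ {y u} → E1 y u → ∃ λ l → y ≡ repOf l
  E1-source (e-lit j k) = φ j k , refl
  E1-source (e-top j k) = φ j k , refl

  E1-source-∉Clause : ∀ {y u j} → E1 y u → ¬ InClause j y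
  E1-source-∉Clause e iy with E1-source e
  ... | (v , s) , refl with iy
  ...   | ()

  E1-clit⇒repOf : ∀ {y j k} → E1 y (clit j k) → y ≡ repOf (φ j k)
  E1-clit⇒repOf (e-lit j k) = refl

  E1-top⇒clit : ∀ {y j} → E1 y (top j) → ∃ λ k → E1 y (clit j k)
  E1-top⇒clit (e-top j k) = k , e-lit j k

  rep-sign-unique : ∀ {v s s′ j k} → E1 (rep v s) (clit j k) → E1 (rep v s′) (clit j k) → s ≡ s′
  rep-sign-unique e e′ with trans (E1-clit⇒repOf e) (sym (E1-clit⇒repOf e′))
  ... | refl = refl

  module _ (O : Orderings) where
    open Orderings O
    open WithOrderings O

    X-top-index : ∀ {v k j} → X v k ≡ top j → toℕ k < a v
    X-top-index {v} {k} eq = ≰⇒> λ a≤k → top≢clit (trans (sym eq) (proj₂ (proj₂ (X-lit v k a≤k))))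

    X-clit-index : ∀ {v k j k′} → X v k ≡ clit j k′ → a v ≤ toℕ k
    X-clit-index {v} {k} eq = ≮⇒≥ λ k<a → top≢clit (trans (sym (proj₂ (X-top v k k<a))) eq)

    Y-clit-index : ∀ {v k j k′} → Y v k ≡ clit j k′ → toℕ k < b v
    Y-clit-index {v} {k} eq = ≰⇒> λ b≤k → top≢clit (trans (sym (proj₂ (Y-top v k b≤k))) eq)

    Y-top-index : ∀ {v k j} → Y v k ≡ top j → b v ≤ toℕ k
    Y-top-index {v} {k} eq = ≮⇒≥ λ k<b → top≢clit (trans (sym eq) (proj₂ (proj₂ (Y-lit v k k<b))))

    TNbr⇒E1 : ∀ {v i u} → TNbr v i u → ∃ λ s → E1 (rep v s) u
    TNbr⇒E1 (inj₁ e , _)                = false , e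
    TNbr⇒E1 {v} (inj₂ (k , _ , refl) , _) = true , Y-into v k

    -- Along t₁, t₂, …, the y's enter literal vertices before tops and the x's leave tops
    -- before literal vertices, so a transition vertex seeing c_⊤ also sees a c_l.
    TNbr-top⇒clit : ∀ {v i j} → TNbr v i (top j) → ∃ λ k → TNbr v i (clit j k)
    TNbr-top⇒clit {v} {i} {j} (inj₁ e , kept) with E1-top⇒clit e | X-onto v (top j) e
    ... | k , e′ | k₁ , eq₁ = k , inj₁ e′ , λ where
      (k″ , lt , eq) → kept (k₁ , <-trans (<-≤-trans (X-top-index eq₁) (X-clit-index eq)) lt , eq₁)
    TNbr-top⇒clit {v} {i} {j} (inj₂ (k₁ , lt₁ , eq₁) , _)
      with E1-top⇒clit (subst (E1 (rep v true)) eq₁ (Y-into v k₁))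
    ... | k , e′ with Y-onto v (clit j k) e′
    ...   | k₂ , eq₂ = k , inj₂ (k₂ , <-trans (<-≤-trans (Y-clit-index eq₂) (Y-top-index eq₁)) lt₁ , eq₂)
                         , λ where
      (k″ , _ , eq) → false≢true (rep-sign-unique (subst (E1 (rep v false)) eq (X-into v k″)) e′)

    Adj-clit : ∀ {x j k} → Adj x (clit j k) → InClause j x ⊎ InVar (var (φ j k)) x
    Adj-clit (inj₁ (e-clique _ ix (inLit _) _)) = inj₁ ix
    Adj-clit (inj₁ (e-one (e-lit j k)))          = inj₂ (repOf∈Var (φ j k))
    Adj-clit {j = j} {k} (inj₁ (e-three v i _ nb)) with TNbr⇒E1 nb
    ... | s , e =
      inj₂ (subst (λ v′ → InVar v′ (tr v i)) (rep≡repOf⇒var (φ j k) (E1-clit⇒repOf e)) (inTr i))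
    Adj-clit (inj₂ (e-clique _ (inLit _) ix _)) = inj₁ ix
    Adj-clit (inj₂ (e-one e))                   = ⊥-elim (E1-source-∉Clause e (inLit _))

    Adj-bot : ∀ {x j} → Adj x (bot j) → InClause j x ⊎ x ≡ γ
    Adj-bot (inj₁ (e-clique _ ix inBot _)) = inj₁ ix
    Adj-bot (inj₁ (e-one ()))
    Adj-bot (inj₁ (e-three v i _ nb)) with TNbr⇒E1 nb
    ... | _ , ()
    Adj-bot (inj₂ (e-clique _ inBot ix _)) = inj₁ ix
    Adj-bot (inj₂ (e-one e))               = ⊥-elim (E1-source-∉Clause e inBot)
    Adj-bot (inj₂ (e-two _))               = inj₂ refl

    Adj-top-outside : ∀ {x j} → Adj x (top j) → ¬ InClause j x → ∃ λ k → Adj x (clit j k)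
    Adj-top-outside (inj₁ (e-clique _ ix inTop _)) x∉ = ⊥-elim (x∉ ix)
    Adj-top-outside (inj₁ (e-one e)) _ with E1-top⇒clit e
    ... | k , e′ = k , inj₁ (e-one e′)
    Adj-top-outside (inj₁ (e-three v i _ nb)) _ with TNbr-top⇒clit nb
    ... | k , nb′ = k , inj₁ (e-three v i _ nb′)
    Adj-top-outside (inj₂ (e-clique _ inTop ix _)) x∉ = ⊥-elim (x∉ ix)
    Adj-top-outside (inj₂ (e-one e)) _ = ⊥-elim (E1-source-∉Clause e inTop)

module Twins {n m} (φ : CNF n m) (O : Construction.Orderings φ) where
  open Construction φ
  open WithOrderings O

  OneTwins-two : ∀ {S u w x y} → OneTwins S u w → Sym S u w x → Sym S u w y → x ≢ y → ⊥
  OneTwins-two (_ , _ , _ , unique) sx sy x≢y = x≢y (unique _ _ sx sy)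

module LastOfVar {n m} (φ : CNF n m) (dv : DistinctVars φ) (O : Construction.Orderings φ)
                 {j : Fin m} {K : Fin 3} {w : Construction.Vtx φ}
                 (w∈ : Construction.InVar φ (var (φ j K)) w) where
  open Construction φ
  open WithOrderings O
  open Neighbourhoods φ
  open Twins φ O

  ¬Adj-clit : ∀ {k} → k ≢ K → ¬ Adj w (clit j k)
  ¬Adj-clit k≢K adj with Adj-clit O adj
  ... | inj₁ iw = InVar⇒¬InClause w∈ iw
  ... | inj₂ iw = k≢K (dv j _ _ (InVar-unique iw w∈))

  ¬Adj-bot : ¬ Adj w (bot j)
  ¬Adj-bot adj with Adj-bot O adj
  ... | inj₁ iw   = InVar⇒¬InClause w∈ iw
  ... | inj₂ refl = γ∉Var w∈

  clause≢w : ∀ {x} → InClause j x → x ≢ w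
  clause≢w ix refl = InVar⇒¬InClause w∈ ix

  module _ {S : Vtx → Set} (clause⊆S : ∀ x → InClause j x → S x)
           (Var∩S⊆w : ∀ u → InVar (var (φ j K)) u → S u → u ≡ w)
           (adj-top : Adj w (top j)) (adj-clit : Adj w (clit j K)) where

    sym-by-clique : ∀ {w′ x} → InClause j w′ → InClause j x → x ≢ w′ → ¬ Adj w x → Sym S w w′ x
    sym-by-clique w′∈ ix x≢w′ ¬adj =
      clause⊆S _ ix , inj₂ (inj₁ (e-clique j w′∈ ix (λ e → x≢w′ (sym e))) , clause≢w ix , ¬adj)

    sym-bot : ∀ {w′} → InClause j w′ → bot j ≢ w′ → Sym S w w′ (bot j)
    sym-bot w′∈ ne = sym-by-clique w′∈ inBot ne ¬Adj-bot

    sym-clit : ∀ {w′ k} → InClause j w′ → k ≢ K → clit j k ≢ w′ → Sym S w w′ (clit j k)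
    sym-clit w′∈ k≢K ne = sym-by-clique w′∈ (inLit _) ne (¬Adj-clit k≢K)

    twin-∉Clause : ∀ {w′} → OneTwins S w w′ → ¬ InClause j w′
    twin-∉Clause twins w′∈@inTop with avoid K K
    ... | c , c≢K , _ =
      OneTwins-two twins (sym-bot w′∈ (λ ())) (sym-clit w′∈ c≢K (λ ())) (λ ())
    twin-∉Clause twins w′∈@inBot with avoid K K
    ... | c , c≢K , _ with avoid K c
    ...   | d , d≢K , d≢c =
      OneTwins-two twins (sym-clit w′∈ c≢K (λ ())) (sym-clit w′∈ d≢K (λ ())) (λ { refl → d≢c refl })
    twin-∉Clause twins w′∈@(inLit k) with avoid K k
    ... | c , c≢K , c≢k =
      OneTwins-two twins (sym-bot w′∈ (λ ())) (sym-clit w′∈ c≢K (λ { refl → c≢k refl })) (λ ())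

    ¬OneTwins : ∀ w′ → ¬ OneTwins S w w′
    ¬OneTwins w′ twins@(w≢w′ , _ , w′∈S , _) =
      OneTwins-two twins sym-clitK sym-top (λ ())
      where
      w′∉Clause : ¬ InClause j w′
      w′∉Clause = twin-∉Clause twins
      ¬Adj-w′-clitK : ¬ Adj w′ (clit j K)
      ¬Adj-w′-clitK adj with Adj-clit O adj
      ... | inj₁ iw′ = w′∉Clause iw′
      ... | inj₂ iw′ = w≢w′ (sym (Var∩S⊆w w′ iw′ w′∈S))
      sym-clitK : Sym S w w′ (clit j K)
      sym-clitK = clause⊆S _ (inLit K)
                , inj₁ (adj-clit , (λ { refl → w′∉Clause (inLit K) }) , ¬Adj-w′-clitK)
      ¬Adj-w′-top : ¬ Adj w′ (top j)
      ¬Adj-w′-top adj with Adj-top-outside O adj w′∉Clause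
      ... | k , adj′ with k F.≟ K
      ...   | yes refl = ¬Adj-w′-clitK adj′
      ...   | no k≢K = OneTwins-two twins sym-clitk sym-clitK (λ { refl → k≢K refl })
        where
        sym-clitk : Sym S w w′ (clit j k)
        sym-clitk = clause⊆S _ (inLit k) , inj₂ (adj′ , clause≢w (inLit k) , ¬Adj-clit k≢K)
      sym-top : Sym S w w′ (top j)
      sym-top = clause⊆S _ inTop , inj₁ (adj-top , (λ { refl → w′∉Clause inTop }) , ¬Adj-w′-top)

lemma6p4 : ∀ {n m} (φ : CNF n m) → DistinctVars φ →
           (∀ v → occ φ v ≡ 2 ⊎ occ φ v ≡ 3) →
           (O : Construction.Orderings φ) →
           (ord : Construction.Vtx φ → ℕ) →
           Construction.WithOrderings.IsEliminationOrder φ O ord →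
           (l : Lit n) (w : Construction.Vtx φ) →
           Construction.InVar φ (var l) w →
           (∀ u → Construction.InVar φ (var l) u → ord u ≤ ord w) →
           (∀ u → Construction.WithOrderings.Adj φ O (Construction.repOf φ l) u →
                  Construction.WithOrderings.Adj φ O w u) →
           ∀ j → hasLit (φ j) l ≡ true →
           ∃ λ x → Construction.InClause φ j x × ord x < ord w
lemma6p4 φ dv _ O ord (ord-inj , hasTwin) l w w∈ w-last N⊆N j hl
  with hasLit⇒position (φ j) l hl
... | K , refl with Neighbourhoods.InClause-any? φ j (λ x → ord x <? ord w)
...   | yes found = found
...   | no none =
  ⊥-elim (¬OneTwins clause⊆S Var∩S⊆w adj-top adj-clit _ (proj₂ (hasTwin w (top j , w<top))))
  where
  open Construction φ
  open WithOrderings O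
  open LastOfVar φ dv O w∈
  clause⊆S : ∀ x → InClause j x → ¬ ord x < ord w
  clause⊆S x ix x<w = none (x , ix , x<w)
  Var∩S⊆w : ∀ u → InVar (var l) u → ¬ ord u < ord w → u ≡ w
  Var∩S⊆w u u∈ u≮w = ord-inj u w (≤-antisym (w-last u u∈) (≮⇒≥ u≮w))
  adj-top : Adj w (top j)
  adj-top = N⊆N (top j) (inj₁ (e-one (e-top j K)))
  adj-clit : Adj w (clit j K)
  adj-clit = N⊆N (clit j K) (inj₁ (e-one (e-lit j K)))
  w<top : ord w < ord (top j)
  w<top = ≤∧≢⇒< (≮⇒≥ (clause⊆S _ inTop)) (λ e → clause≢w inTop (sym (ord-inj w (top j) e)))
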